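{- Let $\alpha,\alpha'$ be two distinct real roots that are either both positive or both negative, with reflections $r=r_\alpha$ and $r'=r_{\alpha'}$. Assume there are arcs $\gamma_r,\gamma_{r'}$ in $D$ with $r_{\gamma_r}=r$ and $r_{\gamma_{r'}}=r'$. Then $(\gamma_r,\gamma_{r'})$ is a bad pair (i.e. $r<r'$ or $r'<r$) if and only if $\langle\alpha,\alpha'\rangle>0$.
   Context: Root system and group. $B=(b_{ij})$ is an $n\times n$ skew-symmetric integer matrix with $b_{ij}\ge2$ for $i<j$. $V$ is a real vector space with basis $v_1,\dots,v_n$ and symmetric bilinear form $\langle v_i,v_i\rangle=2$, $\langle v_i,v_j\rangle=-|b_{ij}|$ ($i\ne j$). Set $r_u(x)=x-\langle x,u\rangle u$ for $\langle u,u\rangle=2$ and $s_i=r_{v_i}$. The group $G=\langle s_i\rangle$ is the free product of $n$ copies of $\mathbb Z/2$. Real roots are the vectors $w(v_i)$, $w\in G$. A real root is positive or negative according as its coordinates in the basis $v_i$ are all $\ge0$ or all $\le0$. Order. $|\cdot|$ is reduced word length in $G$. Each reflection has a unique reduced form $ws_iw^{ -1}$, where the reduced word of $w$ does not end in $s_i$. For $r=ws_iw^{ -1}$ and $r'=w's_jw'^{ -1}$ in reduced form, $r<r'$ means $w'=ws_iu$ with $|s_iu|=|u|+1$. Disc, arcs, reflections. $D=\{\operatorname{Im}z\ge0\}\cup\{\infty\}$ has interior marked points $p_k=k+\mathrm{i}$ and a basepoint $b$ on the real axis. An arc is a non-self-intersecting path from $b$ to some $p_k$ with interior in $\{\operatorname{Im}z>0\}\setminus\{p_i\}$,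 up to isotopy fixing $b$ and the $p_i$. With $\ell_i=\{\operatorname{Re}z=i,\operatorname{Im}z>1\}$: if an arc ending at $p_k$ crosses $\ell_{i_1},\dots,\ell_{i_l}$ in this order, its reflection is $s_{i_1}\cdots s_{i_l}s_ks_{i_l}\cdots s_{i_1}$. -}

module Defs where

open import Data.Nat as ℕ using (ℕ; zero; suc)
open import Data.Fin using (Fin; toℕ)
open import Data.Fin.Properties using () renaming (_≟_ to _≟ᶠ_)
open import Data.Integer as ℤ using (ℤ; +_; ∣_∣)
open import Data.Rational as ℚ using (ℚ; 0ℚ; 1ℚ)
open import Data.Rational.Properties using (_<?_)
open import Data.List using (List; []; _∷_; _++_; reverse; length; lookup; zip; filterᵇ; allFin; concatMap; [_])
open import Data.List.Membership.Propositional using (_∈_)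
open import Data.Bool using (Bool; true; false; if_then_else_; _∧_)
open import Data.Product using (Σ; ∃; ∃-syntax; _×_; _,_; proj₁; proj₂)
open import Data.Sum using (_⊎_)
open import Relation.Nullary using (¬_; does)
open import Relation.Binary.PropositionalEquality using (_≡_; _≢_)

record ExchangeMatrix (n : ℕ) : Set where
  field
    b        : Fin n → Fin n → ℤ
    skew     : ∀ i j → b i j ≡ ℤ.- b j i
    bigAbove : ∀ i j → toℕ i ℕ.< toℕ j → + 2 ℤ.≤ b i j
open ExchangeMatrix public

-- Vectors of V (roots have integer coordinates w.r.t. v_1..v_n).
Vect : ℕ → Set
Vect n = Fin n → ℤ

∑ : ∀ {n} → (Fin n → ℤ) → ℤ
∑ {zero}  f = + 0
∑ {suc n} f = f Fin.zero ℤ.+ ∑ {n} (λ i → f (Fin.suc i))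
  where import Data.Fin as Fin

gram : ∀ {n} → ExchangeMatrix n → Fin n → Fin n → ℤ
gram B i j = if does (i ≟ᶠ j) then + 2 else ℤ.- (+ ∣ b B i j ∣)

form : ∀ {n} → ExchangeMatrix n → Vect n → Vect n → ℤ
form B x y = ∑ (λ i → ∑ (λ j → x i ℤ.* y j ℤ.* gram B i j))

basis : ∀ {n} → Fin n → Vect n
basis i j = if does (i ≟ᶠ j) then + 1 else + 0

reflect : ∀ {n} → ExchangeMatrix n → Vect n → Vect n → Vect n
reflect B u x k = x k ℤ.- form B x u ℤ.* u k

-- Words in the generators s_i; the word i₁ ∷ … ∷ i_l denotes s_{i₁}⋯s_{i_l}.
Word : ℕ → Set
Word n = List (Fin n)

act : ∀ {n} → ExchangeMatrix n → Word n → Vect n → Vect n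
act B []      x = x
act B (i ∷ w) x = reflect B (basis i) (act B w x)

-- Free reduction (G is the free product of copies of ℤ/2, so elements
-- of G are exactly the reduced words).
push : ∀ {n} → Fin n → Word n → Word n
push i []      = i ∷ []
push i (j ∷ w) = if does (i ≟ᶠ j) then w else i ∷ j ∷ w

reduce : ∀ {n} → Word n → Word n
reduce []      = []
reduce (i ∷ w) = push i (reduce w)

data Reduced {n : ℕ} : Word n → Set where
  nil  : Reduced []
  one  : ∀ i → Reduced (i ∷ [])
  cons : ∀ {i j w} → i ≢ j → Reduced (j ∷ w) → Reduced (i ∷ j ∷ w)

wlen : ∀ {n} → Word n → ℕ
wlen w = length (reduce w)

RealRoot : ∀ {n} → ExchangeMatrix n → Vect n → Set
RealRoot B α = ∃[ w ] ∃[ i ] (∀ k → α k ≡ act B w (basis i) k)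

Positive Negative : ∀ {n} → Vect n → Set
Positive α = ∀ k → + 0 ℤ.≤ α k
Negative α = ∀ k → α k ℤ.≤ + 0

-- r is (the reduced word of) the element of G acting as r_α
IsReflectionOf : ∀ {n} → ExchangeMatrix n → Word n → Vect n → Set
IsReflectionOf B r α = Reduced r × (∀ x k → act B r x k ≡ reflect B α x k)

_≺_ : ∀ {n} → Word n → Word n → Set
r ≺ r' = ∃[ w ] ∃[ i ] ∃[ w' ] ∃[ j ] ∃[ u ]
           ( r ≡ w ++ i ∷ reverse w
           × r' ≡ w' ++ j ∷ reverse w'
           × Reduced r × Reduced r'
           × w' ≡ reduce (w ++ i ∷ u)
           × wlen (i ∷ u) ≡ suc (wlen u) )

-- Arcs, modelled as polygonal paths with rational vertices

Pt : Set
Pt = ℚ × ℚ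

ℕtoℚ : ℕ → ℚ
ℕtoℚ m = (+ m) ℚ./ 1

-- marked point p_k = k + i, for k = 1..n (index m : Fin n is p_{m+1})
marked : ∀ {n} → Fin n → Pt
marked m = (ℕtoℚ (suc (toℕ m)) , 1ℚ)

base : Pt
base = (0ℚ , 0ℚ)

Seg : Set
Seg = Pt × Pt

ptAt : Seg → ℚ → Pt
ptAt ((x₀ , y₀) , (x₁ , y₁)) s = (x₀ ℚ.+ s ℚ.* (x₁ ℚ.- x₀) , y₀ ℚ.+ s ℚ.* (y₁ ℚ.- y₀))

record Arc (n : ℕ) : Set where
  constructor arc
  field
    mids : List Pt
    end  : Fin n
open Arc public

vertices : ∀ {n} → Arc n → List Pt
vertices γ = base ∷ mids γ ++ [ marked (end γ) ]

segments : ∀ {n} → Arc n → List Seg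
segments γ with vertices γ
... | []     = []
... | v ∷ vs = zip (v ∷ vs) vs

InUnit : ℚ → Set
InUnit s = 0ℚ ℚ.≤ s × s ℚ.≤ 1ℚ

record ValidArc {n : ℕ} (γ : Arc n) : Set where
  field
    genericVertices : ∀ v → v ∈ mids γ → ∀ (m : Fin n) → proj₁ v ≢ ℕtoℚ (suc (toℕ m))
    -- non-self-intersecting: the parametrisation is injective
    simple : ∀ (a c : Fin (length (segments γ))) (s t : ℚ) → InUnit s → InUnit t →
             ptAt (lookup (segments γ) a) s ≡ ptAt (lookup (segments γ) c) t →
             (a ≡ c × s ≡ t)
             ⊎ (toℕ c ≡ suc (toℕ a) × s ≡ 1ℚ × t ≡ 0ℚ)
             ⊎ (toℕ a ≡ suc (toℕ c) × s ≡ 0ℚ × t ≡ 1ℚ)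
    -- interior in the open upper half plane (only b lies on the real axis)
    upper : ∀ (a : Fin (length (segments γ))) (s : ℚ) → InUnit s →
            proj₂ (ptAt (lookup (segments γ) a) s) ℚ.≤ 0ℚ →
            ptAt (lookup (segments γ) a) s ≡ base
    -- the interior avoids the marked points (only the endpoint is marked)
    avoid : ∀ (a : Fin (length (segments γ))) (s : ℚ) → InUnit s → ∀ (m : Fin n) →
            ptAt (lookup (segments γ) a) s ≡ marked m →
            ptAt (lookup (segments γ) a) s ≡ marked (end γ)

-- does segment ((x₀,y₀),(x₁,y₁)) cross ℓ at Re z = c above height 1?
-- c strictly between x₀,x₁ : (c - x₀)(x₁ - c) > 0;
-- crossing height y_c > 1  ⇔  (x₁-x₀)·((x₁-c)(y₀-1) + (c-x₀)(y₁-1)) > 0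
-- (the latter equals (x₁-x₀)² (y_c - 1)).
crossesᵇ : Seg → ℚ → Bool
crossesᵇ ((x₀ , y₀) , (x₁ , y₁)) c =
  does (0ℚ <? (c ℚ.- x₀) ℚ.* (x₁ ℚ.- c))
  ∧ does (0ℚ <? (x₁ ℚ.- x₀) ℚ.* ((x₁ ℚ.- c) ℚ.* (y₀ ℚ.- 1ℚ) ℚ.+ (c ℚ.- x₀) ℚ.* (y₁ ℚ.- 1ℚ)))

-- the lines ℓ_i crossed by a segment, in the order of traversal
segCrossings : ∀ {n} → Seg → Word n
segCrossings {n} σ@((x₀ , _) , (x₁ , _)) =
  let cs = filterᵇ (λ m → crossesᵇ σ (ℕtoℚ (suc (toℕ m)))) (allFin n)
  in if does (x₀ <? x₁) then cs else reverse cs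

crossings : ∀ {n} → Arc n → Word n
crossings γ = concatMap segCrossings (segments γ)

arcReflection : ∀ {n} → Arc n → Word n
arcReflection γ = reduce (crossings γ ++ end γ ∷ reverse (crossings γ))

HasArc : ∀ {n} → Word n → Set
HasArc {n} r = ∃[ γ ] (ValidArc {n} γ × arcReflection γ ≡ r)

-- Write β = w(v_i) for the root of a reflection in conjugate form
-- w s_i w⁻¹.  The argument has three ingredients.
--
-- 1. Free reduction.  Reduced words are the normal forms of the rewriting
--    p a a q ⟶ p q, so the reduced form of c s_k c⁻¹ is again a
--    palindrome w s_i w⁻¹ with w s_i reduced; in particular every arc
--    reflection has this shape.
-- 2. Linear algebra of the form: reflections are self-adjoint isometric
--    involutions, w s_i w⁻¹ acts as the reflection in w(v_i), and a
--    reflection determines its root up to sign.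
-- 3. Ping-pong.  Since every off-diagonal Gram entry is ≤ -2, if z s_j is
--    reduced then z(v_j) is non-negative, and every simple root other than
--    the first letter of z s_j pairs with z(v_j) at most -2.
--
-- By 2 and 3 the positive (or negative) roots α, α' are ε·w(v_i) and
-- ε·w'(v_j) for a common sign ε.  Then r ≺ r' gives ⟨α,α'⟩ ≥ 2, and
-- conversely ⟨α,α'⟩ > 0 forces one of w s_i, w' s_j to be a prefix of the
-- other, which is r ≺ r' or r' ≺ r.
module Submission where

open import Defs
open import Data.Nat using (ℕ)
open import Data.Integer using (ℤ; +_; _<_)
open import Data.Fin using (Fin)
open import Data.Product using (_×_)
open import Data.Sum using (_⊎_)
open import Relation.Nullary using (¬_)
open import Relation.Binary.PropositionalEquality using (_≡_)
open import Function.Bundles using (_⇔_)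

open import Data.Nat using (zero; suc; z≤n; s≤s)
import Data.Nat.Properties as ℕP
open import Data.Fin using (toℕ) renaming (zero to fzero; suc to fsuc)
open import Data.Fin.Properties using (toℕ-injective; suc-injective) renaming (_≟_ to _≟ᶠ_)
open import Data.Integer as ℤ using (∣_∣; _+_; _*_; -_; _-_; _≤_; +≤+; +<+)
import Data.Integer.Properties as ℤP
open import Data.Integer.Tactic.RingSolver using (solve-∀)
open import Algebra.Properties.Semiring.Sum ℤP.+-*-semiring
  using (sum; sum-cong-≗; *-distribˡ-sum) renaming (∑-distrib-+ to sum-distrib-+; ∑-comm to sum-comm)
open import Data.List using (List; []; _∷_; _++_; reverse; length; [_]; _∷ʳ_)
open import Data.List.Properties using (++-assoc; reverse-++; unfold-reverse; ʳ++-defn)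
open import Data.List.Reverse using (Reverse; []; _∶_∶ʳ_; reverseView)
open import Data.Product using (∃-syntax; _,_; proj₁; proj₂; swap)
open import Data.Sum as Sum using (inj₁; inj₂)
open import Data.Bool using (if_then_else_)
open import Function using (flip)
open import Relation.Nullary using (Dec; yes; no; contradiction)
open import Relation.Nullary.Decidable using (dec-true; dec-false)
open import Relation.Binary.Definitions using (tri<; tri≈; tri>)
open import Relation.Binary.PropositionalEquality
  using (_≢_; _≗_; refl; sym; trans; cong; cong₂; subst; subst₂; ≢-sym; module ≡-Reasoning)
open import Relation.Binary.Construct.Closure.ReflexiveTransitive using (Star; ε; _◅_; _◅◅_; gmap)
open import Function.Bundles using (mk⇔)

-- Words: reduced words, free reduction and conjugate forms.
module _ {n : ℕ} where

  reduced-tail : ∀ {a : Fin n} {w} → Reduced (a ∷ w) → Reduced w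
  reduced-tail (one _)    = nil
  reduced-tail (cons _ r) = r

  reduced-prefix : ∀ (x : Word n) {y} → Reduced (x ++ y) → Reduced x
  reduced-prefix []          _           = nil
  reduced-prefix (a ∷ [])    _           = one a
  reduced-prefix (a ∷ c ∷ x) (cons ne r) = cons ne (reduced-prefix (c ∷ x) r)

  reduced-suffix : ∀ (x : Word n) {y} → Reduced (x ++ y) → Reduced y
  reduced-suffix []      r = r
  reduced-suffix (a ∷ x) r = reduced-suffix x (reduced-tail r)

  reduced-join : ∀ (x : Word n) c {y} → Reduced (x ++ [ c ]) → Reduced (c ∷ y) → Reduced (x ++ c ∷ y)
  reduced-join []          c _           r₂ = r₂
  reduced-join (a ∷ [])    c (cons ne _) r₂ = cons ne r₂
  reduced-join (a ∷ d ∷ x) c (cons ne r) r₂ = cons ne (reduced-join (d ∷ x) c r r₂)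

  reduced-reverse : ∀ {w : Word n} → Reduced w → Reduced (reverse w)
  reduced-reverse nil     = nil
  reduced-reverse (one a) = one a
  reduced-reverse {a ∷ c ∷ w} (cons a≢c r) =
    subst Reduced (sym (ʳ++-defn w))
      (reduced-join (reverse w) c (subst Reduced (unfold-reverse c w) (reduced-reverse r)) (cons (≢-sym a≢c) (one a)))

  palindrome-prefix : ∀ {r : Word n} {w i} → Reduced r → r ≡ w ++ i ∷ reverse w → Reduced (w ++ [ i ])
  palindrome-prefix {w = w} {i} red refl =
    reduced-prefix (w ++ [ i ]) (subst Reduced (sym (++-assoc w [ i ] (reverse w))) red)

  reduced-palindrome : ∀ (d : Word n) k → Reduced (d ++ [ k ]) → Reduced (d ++ k ∷ reverse d)
  reduced-palindrome d k red = reduced-join d k red (subst Reduced (reverse-++ d [ k ]) (reduced-reverse red))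

  -- the first letter of the word  z s_j
  head-or : Word n → Fin n → Fin n
  head-or []      j = j
  head-or (a ∷ _) j = a

  head-or-≢ : ∀ {a : Fin n} z j → Reduced (a ∷ z ++ [ j ]) → a ≢ head-or z j
  head-or-≢ []      j (cons ne _) = ne
  head-or-≢ (_ ∷ _) j (cons ne _) = ne

  reduced-cons-head : ∀ {a : Fin n} z j → a ≢ head-or z j → Reduced (z ++ [ j ]) → Reduced (a ∷ z ++ [ j ])
  reduced-cons-head []      j ne _ = cons ne (one j)
  reduced-cons-head (_ ∷ _) j ne r = cons ne r

  reverse-cons-++ : ∀ (a : Fin n) w {y} → reverse (a ∷ w) ++ y ≡ reverse w ++ a ∷ y
  reverse-cons-++ a w {y} = trans (cong (_++ y) (unfold-reverse a w)) (++-assoc (reverse w) [ a ] y)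

  reduced-zigzag : ∀ (w : Word n) i w' j → Reduced (w ++ [ i ]) → Reduced (w' ++ [ j ]) →
                   head-or w i ≢ head-or w' j → Reduced (i ∷ (reverse w ++ w') ++ [ j ])
  reduced-zigzag []      i w' j _ r' heads≢ = reduced-cons-head w' j heads≢ r'
  reduced-zigzag (a ∷ w) i w' j r r' heads≢ =
    subst Reduced (sym word≡) (reduced-join (i ∷ reverse w) a reversed (reduced-cons-head w' j heads≢ r'))
    where
      word≡ : i ∷ (reverse (a ∷ w) ++ w') ++ [ j ] ≡ (i ∷ reverse w) ++ a ∷ w' ++ [ j ]
      word≡ = cong (i ∷_) (begin
          (reverse (a ∷ w) ++ w') ++ [ j ]  ≡⟨ ++-assoc (reverse (a ∷ w)) w' [ j ] ⟩
          reverse (a ∷ w) ++ w' ++ [ j ]    ≡⟨ reverse-cons-++ a w ⟩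
          reverse w ++ a ∷ w' ++ [ j ]      ∎)
        where open ≡-Reasoning
      reversed : Reduced ((i ∷ reverse w) ++ [ a ])
      reversed = subst Reduced (trans (reverse-++ (a ∷ w) [ i ]) (cong (i ∷_) (unfold-reverse a w)))
                   (reduced-reverse r)

  infix 4 _⟶_ _⟶*_
  data _⟶_ : Word n → Word n → Set where
    cancel : ∀ p a q → p ++ a ∷ a ∷ q ⟶ p ++ q

  _⟶*_ : Word n → Word n → Set
  _⟶*_ = Star _⟶_

  reverse-around : ∀ (p : Word n) a q → reverse (p ++ a ∷ a ∷ q) ≡ reverse q ++ a ∷ a ∷ reverse p
  reverse-around p a q = trans (reverse-++ p (a ∷ a ∷ q))
    (trans (cong (_++ reverse p) (ʳ++-defn q)) (++-assoc (reverse q) (a ∷ a ∷ []) (reverse p)))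

  ⟶*-prefix : ∀ x {y z : Word n} → y ⟶* z → x ++ y ⟶* x ++ z
  ⟶*-prefix x = gmap (x ++_) step
    where
      step : ∀ {y z} → y ⟶ z → x ++ y ⟶ x ++ z
      step (cancel p a q) = subst₂ _⟶_ (++-assoc x p _) (++-assoc x p q) (cancel (x ++ p) a q)

  ⟶*-suffix : ∀ x {y z : Word n} → y ⟶* z → y ++ x ⟶* z ++ x
  ⟶*-suffix x = gmap (_++ x) step
    where
      step : ∀ {y z} → y ⟶ z → y ++ x ⟶ z ++ x
      step (cancel p a q) =
        subst₂ _⟶_ (sym (++-assoc p (a ∷ a ∷ q) x)) (sym (++-assoc p q x)) (cancel p a (q ++ x))

  ⟶*-reverse : ∀ {y z : Word n} → y ⟶* z → reverse y ⟶* reverse z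
  ⟶*-reverse = gmap reverse step
    where
      step : ∀ {y z} → y ⟶ z → reverse y ⟶ reverse z
      step (cancel p a q) =
        subst₂ _⟶_ (sym (reverse-around p a q)) (sym (reverse-++ p q)) (cancel (reverse q) a (reverse p))

  push-self : ∀ (a : Fin n) v → push a (a ∷ v) ≡ v
  push-self a v = cong (λ d → if d then v else a ∷ a ∷ v) (dec-true (a ≟ᶠ a) refl)

  push-fresh : ∀ {a c : Fin n} v → a ≢ c → push a (c ∷ v) ≡ a ∷ c ∷ v
  push-fresh {a} {c} v a≢c = cong (λ d → if d then v else a ∷ c ∷ v) (dec-false (a ≟ᶠ c) a≢c)

  push-reduced : ∀ {a : Fin n} {v} → Reduced (a ∷ v) → push a v ≡ a ∷ v
  push-reduced {v = []}    _           = refl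
  push-reduced {v = _ ∷ v} (cons ne _) = push-fresh v ne

  push-preserves : ∀ (a : Fin n) {v} → Reduced v → Reduced (push a v)
  push-preserves a nil = one a
  push-preserves a {c ∷ v} r with a ≟ᶠ c
  ... | yes _ = reduced-tail r
  ... | no ne = cons ne r

  reduce-reduced : ∀ (w : Word n) → Reduced (reduce w)
  reduce-reduced []      = nil
  reduce-reduced (a ∷ w) = push-preserves a (reduce-reduced w)

  reduce-id : ∀ {w : Word n} → Reduced w → reduce w ≡ w
  reduce-id {[]}    _ = refl
  reduce-id {a ∷ w} r = trans (cong (push a) (reduce-id (reduced-tail r))) (push-reduced r)

  push-push : ∀ (a : Fin n) {v} → Reduced v → push a (push a v) ≡ v
  push-push a {[]}    _ = push-self a []
  push-push a {c ∷ v} r with a ≟ᶠ c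
  ... | yes refl = push-reduced r
  ... | no _     = push-self a (c ∷ v)

  reduce-cancel : ∀ (p : Word n) a q → reduce (p ++ a ∷ a ∷ q) ≡ reduce (p ++ q)
  reduce-cancel []      a q = push-push a (reduce-reduced q)
  reduce-cancel (c ∷ p) a q = cong (push c) (reduce-cancel p a q)

  reduce-⟶* : ∀ {x y : Word n} → x ⟶* y → reduce x ≡ reduce y
  reduce-⟶* ε                      = refl
  reduce-⟶* (cancel p a q ◅ steps) = trans (reduce-cancel p a q) (reduce-⟶* steps)

  ⟶*-reduce : ∀ (w : Word n) → w ⟶* reduce w
  ⟶*-reduce []      = ε
  ⟶*-reduce (a ∷ w) = ⟶*-prefix [ a ] (⟶*-reduce w) ◅◅ cons⟶*push (reduce w)
    where
      cons⟶*push : ∀ v → a ∷ v ⟶* push a v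
      cons⟶*push []      = ε
      cons⟶*push (c ∷ v) with a ≟ᶠ c
      ... | yes refl = cancel [] a v ◅ ε
      ... | no _     = ε

  Palindrome : Word n → Set
  Palindrome r = ∃[ w ] ∃[ i ] (r ≡ w ++ i ∷ reverse w)

  -- For reduced d, the reduced form of d s_k d⁻¹ is a conjugate form:
  -- peel off the last letter of d while it equals k.
  reduce-palindrome : ∀ {d : Word n} → Reverse d → Reduced d → ∀ k → Palindrome (reduce (d ++ k ∷ reverse d))
  reduce-palindrome []               _   k = [] , k , refl
  reduce-palindrome (d ∶ view ∶ʳ a) red k with k ≟ᶠ a
  ... | yes refl = subst Palindrome (sym (trans (cong reduce unfold) (reduce-cancel d k (k ∷ reverse d))))
                     (reduce-palindrome view (reduced-prefix d red) k)
    where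
      unfold : (d ∷ʳ k) ++ k ∷ reverse (d ∷ʳ k) ≡ d ++ k ∷ k ∷ k ∷ reverse d
      unfold = trans (++-assoc d [ k ] _) (cong (λ t → d ++ k ∷ k ∷ t) (reverse-++ d [ k ]))
  ... | no k≢a = d ∷ʳ a , k , reduce-id (reduced-palindrome (d ∷ʳ a) k dak)
    where
      dak : Reduced ((d ∷ʳ a) ++ [ k ])
      dak = subst Reduced (sym (++-assoc d [ a ] [ k ])) (reduced-join d a red (cons (≢-sym k≢a) (one k)))

  -- Any word c s_k c⁻¹ reduces to a conjugate form: cancel inside c and
  -- c⁻¹ first, then apply reduce-palindrome.
  reduce-conjugate : ∀ (c : Word n) k → Palindrome (reduce (c ++ k ∷ reverse c))
  reduce-conjugate c k =
    subst Palindrome (sym (reduce-⟶* steps)) (reduce-palindrome (reverseView d) (reduce-reduced c) k)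
    where
      d = reduce c
      steps : c ++ k ∷ reverse c ⟶* d ++ k ∷ reverse d
      steps = ⟶*-suffix (k ∷ reverse c) (⟶*-reduce c)
           ◅◅ ⟶*-prefix d (⟶*-prefix [ k ] (⟶*-reverse (⟶*-reduce c)))

  arc-palindrome : ∀ {r : Word n} → HasArc r → Palindrome r
  arc-palindrome (γ , _ , refl) = reduce-conjugate (crossings γ) (end γ)

  push-lengthening : ∀ (i : Fin n) U → length (push i U) ≡ suc (length U) → push i U ≡ i ∷ U
  push-lengthening i []      _ = refl
  push-lengthening i (c ∷ U) len with i ≟ᶠ c
  ... | yes refl = contradiction len (ℕP.m≢1+n+m (length U) {1})
  ... | no _     = refl

  record Extension (r r' : Word n) : Set where
    field
      w   : Word n
      i   : Fin n
      U   : Word n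
      j   : Fin n
      r≡  : r ≡ w ++ i ∷ reverse w
      r'≡ : r' ≡ (w ++ i ∷ U) ++ j ∷ reverse (w ++ i ∷ U)
      reduced : Reduced (i ∷ U ++ [ j ])

  -- In r ≺ r' the condition |s_i u| = |u| + 1 says that nothing cancels,
  -- so w' = w s_i (reduce u).
  ≺⇒extension : ∀ {r r' : Word n} → r ≺ r' → Extension r r'
  ≺⇒extension {r' = r'} (w , i , w' , j , u , r≡ , r'≡ , red-r , red-r' , w'≡ , lengthens) =
    record { w = w ; i = i ; U = reduce u ; j = j ; r≡ = r≡
           ; r'≡ = subst (λ v → r' ≡ v ++ j ∷ reverse v) w'≡wiU r'≡
           ; reduced = reduced-suffix w (subst Reduced (trans (cong (_++ [ j ]) w'≡wiU) (++-assoc w _ [ j ]))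
                                           (palindrome-prefix red-r' r'≡)) }
    where
      iU≡ : push i (reduce u) ≡ i ∷ reduce u
      iU≡ = push-lengthening i (reduce u) lengthens
      w'≡wiU : w' ≡ w ++ i ∷ reduce u
      w'≡wiU = begin
          w'                                ≡⟨ w'≡ ⟩
          reduce (w ++ i ∷ u)               ≡⟨ reduce-⟶* (⟶*-prefix w (⟶*-reduce (i ∷ u))) ⟩
          reduce (w ++ push i (reduce u))   ≡⟨ cong (λ v → reduce (w ++ v)) iU≡ ⟩
          reduce (w ++ i ∷ reduce u)        ≡⟨ reduce-id (reduced-join w i (palindrome-prefix red-r r≡)
                                                 (subst Reduced iU≡ (reduce-reduced (i ∷ u)))) ⟩
          w ++ i ∷ reduce u                 ∎
        where open ≡-Reasoning

  extension⇒≺ : ∀ {r r' : Word n} {w i w' j} u → r ≡ w ++ i ∷ reverse w → r' ≡ w' ++ j ∷ reverse w' →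
                Reduced r → Reduced r' → w' ≡ w ++ i ∷ u → r ≺ r'
  extension⇒≺ {w = w} {i} {w'} {j} u r≡ r'≡ red-r red-r' w'≡ =
    w , i , w' , j , u , r≡ , r'≡ , red-r , red-r' , trans w'≡ (sym (reduce-id red-wiu)) , lengthens
    where
      red-wiu : Reduced (w ++ i ∷ u)
      red-wiu = subst Reduced w'≡ (reduced-prefix w' (subst Reduced r'≡ red-r'))
      red-iu : Reduced (i ∷ u)
      red-iu = reduced-suffix w red-wiu
      lengthens : wlen (i ∷ u) ≡ suc (wlen u)
      lengthens = trans (cong length (reduce-id red-iu)) (cong suc (sym (cong length (reduce-id (reduced-tail red-iu)))))

  Nested : Word n → Fin n → Word n → Fin n → Set
  Nested w i w' j = (w ≡ w' × i ≡ j) ⊎ (∃[ u ] w' ≡ w ++ i ∷ u) ⊎ (∃[ u ] w ≡ w' ++ j ∷ u)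

  nested-cons : ∀ a {w i w' j} → Nested w i w' j → Nested (a ∷ w) i (a ∷ w') j
  nested-cons a (inj₁ (w≡ , i≡))        = inj₁ (cong (a ∷_) w≡ , i≡)
  nested-cons a (inj₂ (inj₁ (u , w'≡))) = inj₂ (inj₁ (u , cong (a ∷_) w'≡))
  nested-cons a (inj₂ (inj₂ (u , w≡)))  = inj₂ (inj₂ (u , cong (a ∷_) w≡))

-- The sum ∑ of the definitions is the library's sum over the semiring ℤ;
-- its properties are transported from there.
∑≡sum : ∀ {m} (f : Fin m → ℤ) → ∑ f ≡ sum f
∑≡sum {zero}  f = refl
∑≡sum {suc m} f = cong (_+_ (f fzero)) (∑≡sum (λ i → f (fsuc i)))

∑-cong : ∀ {m} {f g : Fin m → ℤ} → f ≗ g → ∑ f ≡ ∑ g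
∑-cong {f = f} {g} f≗g = trans (∑≡sum f) (trans (sum-cong-≗ f≗g) (sym (∑≡sum g)))

∑-+ : ∀ {m} (f g : Fin m → ℤ) → ∑ (λ i → f i + g i) ≡ ∑ f + ∑ g
∑-+ f g = trans (∑≡sum (λ i → f i + g i))
  (trans (sum-distrib-+ f g) (sym (cong₂ _+_ (∑≡sum f) (∑≡sum g))))

∑-*ˡ : ∀ {m} c (f : Fin m → ℤ) → ∑ (λ i → c * f i) ≡ c * ∑ f
∑-*ˡ c f = trans (∑≡sum (λ i → c * f i)) (trans (sym (*-distribˡ-sum c f)) (cong (c *_) (sym (∑≡sum f))))

∑-comm : ∀ {m p} (h : Fin m → Fin p → ℤ) → ∑ (λ i → ∑ (h i)) ≡ ∑ (λ j → ∑ (λ i → h i j))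
∑-comm h = trans (double h) (trans (sum-comm h) (sym (double (flip h))))
  where
    double : ∀ {m p} (h : Fin m → Fin p → ℤ) → ∑ (λ i → ∑ (h i)) ≡ sum (λ i → sum (h i))
    double h = trans (∑≡sum (λ i → ∑ (h i))) (sum-cong-≗ (λ i → ∑≡sum (h i)))

∑-δ : ∀ {m} (f : Fin m → ℤ) k → (∀ i → i ≢ k → f i ≡ + 0) → ∑ f ≡ f k
∑-δ {suc m} f fzero    vanish =
  trans (cong (_+_ (f fzero)) (∑-zero (λ i → vanish (fsuc i) λ ()))) (ℤP.+-identityʳ _)
  where
    ∑-zero : ∀ {m} {g : Fin m → ℤ} → (∀ i → g i ≡ + 0) → ∑ g ≡ + 0
    ∑-zero {zero}  _ = refl
    ∑-zero {suc m} z = cong₂ _+_ (z fzero) (∑-zero (λ i → z (fsuc i)))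
∑-δ {suc m} f (fsuc k) vanish =
  trans (cong (_+ ∑ (λ i → f (fsuc i))) (vanish fzero λ ())) (trans (ℤP.+-identityˡ _)
    (∑-δ (λ i → f (fsuc i)) k (λ i i≢k → vanish (fsuc i) (λ e → i≢k (suc-injective e)))))

square-four : ∀ c → c * c ≡ + 4 → c ≡ + 2 ⊎ c ≡ - + 2
square-four c c²≡4 =
  Sum.map (ℤP.i-j≡0⇒i≡j c (+ 2)) (ℤP.i-j≡0⇒i≡j c (- + 2)) (ℤP.i*j≡0⇒i≡0∨j≡0 (c - + 2) factored)
  where
    difference-of-squares : ∀ c → (c - + 2) * (c + + 2) ≡ c * c - + 4
    difference-of-squares = solve-∀
    factored : (c - + 2) * (c - - + 2) ≡ + 0
    factored = trans (difference-of-squares c) (cong (_- + 4) c²≡4)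

-- The form, reflections, the action of words, and ping-pong.
module _ {n : ℕ} (B : ExchangeMatrix n) where

  ⟨_,_⟩ : Vect n → Vect n → ℤ
  ⟨ x , y ⟩ = form B x y

  neg : Vect n → Vect n
  neg x k = - x k

  basis-diag : ∀ k → basis {n} k k ≡ + 1
  basis-diag k = cong (λ d → if d then + 1 else + 0) (dec-true (k ≟ᶠ k) refl)

  basis-off : ∀ {k i : Fin n} → k ≢ i → basis k i ≡ + 0
  basis-off {k} {i} k≢i = cong (λ d → if d then + 1 else + 0) (dec-false (k ≟ᶠ i) k≢i)

  basis-nonneg : ∀ (a k : Fin n) → + 0 ≤ basis a k
  basis-nonneg a k with a ≟ᶠ k
  ... | yes _ = +≤+ z≤n
  ... | no _  = +≤+ z≤n

  gram-diag : ∀ k → gram B k k ≡ + 2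
  gram-diag k = cong (λ d → if d then + 2 else - (+ ∣ b B k k ∣)) (dec-true (k ≟ᶠ k) refl)

  gram-off : ∀ {k i} → k ≢ i → gram B k i ≡ - (+ ∣ b B k i ∣)
  gram-off {k} {i} k≢i = cong (λ d → if d then + 2 else - (+ ∣ b B k i ∣)) (dec-false (k ≟ᶠ i) k≢i)

  -- B is skew-symmetric, so |b_ki| = |b_ik| and the Gram matrix is symmetric.
  |b|-sym : ∀ k i → ∣ b B k i ∣ ≡ ∣ b B i k ∣
  |b|-sym k i = trans (cong ∣_∣ (skew B k i)) (ℤP.∣-i∣≡∣i∣ (b B i k))

  gram-sym : ∀ k i → gram B k i ≡ gram B i k
  gram-sym k i = by-cases (k ≟ᶠ i)
    where
      by-cases : Dec (k ≡ i) → gram B k i ≡ gram B i k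
      by-cases (yes k≡i) = cong₂ (gram B) k≡i (sym k≡i)
      by-cases (no k≢i)  =
        trans (gram-off k≢i) (trans (cong (λ t → - (+ t)) (|b|-sym k i)) (sym (gram-off (≢-sym k≢i))))

  -- Off the diagonal the Gram matrix is at most -2, since |b_ki| ≥ 2.
  gram-off≤-2 : ∀ {k i} → k ≢ i → gram B k i ≤ - + 2
  gram-off≤-2 {k} {i} k≢i = subst (_≤ - + 2) (sym (gram-off k≢i)) (ℤP.neg-mono-≤ |b|≥2)
    where
      abs≥2 : ∀ {x} → + 2 ≤ x → + 2 ≤ + ∣ x ∣
      abs≥2 {+ _} h = h
      |b|≥2 : + 2 ≤ + ∣ b B k i ∣
      |b|≥2 with ℕP.<-cmp (toℕ k) (toℕ i)
      ... | tri< k<i _ _ = abs≥2 (bigAbove B k i k<i)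
      ... | tri≈ _ k≡i _ = contradiction (toℕ-injective k≡i) k≢i
      ... | tri> _ _ i<k = subst (λ t → + 2 ≤ + t) (|b|-sym i k) (abs≥2 (bigAbove B i k i<k))

  pairing : Vect n → Fin n → ℤ
  pairing y i = ∑ (λ j → y j * gram B i j)

  form-pairing : ∀ x y → ⟨ x , y ⟩ ≡ ∑ (λ i → x i * pairing y i)
  form-pairing x y = ∑-cong (λ i →
    trans (∑-cong (λ j → ℤP.*-assoc (x i) (y j) _)) (∑-*ˡ (x i) (λ j → y j * gram B i j)))

  form-cong : ∀ {x x' y y'} → x ≗ x' → y ≗ y' → ⟨ x , y ⟩ ≡ ⟨ x' , y' ⟩
  form-cong x≗ y≗ = ∑-cong (λ i → ∑-cong (λ j → cong₂ (λ p q → p * q * _) (x≗ i) (y≗ j)))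

  form-congˡ : ∀ {x x'} y → x ≗ x' → ⟨ x , y ⟩ ≡ ⟨ x' , y ⟩
  form-congˡ {x} {x'} y x≗ = form-cong {x} {x'} {y} {y} x≗ (λ _ → refl)

  form-congʳ : ∀ x {y y'} → y ≗ y' → ⟨ x , y ⟩ ≡ ⟨ x , y' ⟩
  form-congʳ x {y} {y'} y≗ = form-cong {x} {x} {y} {y'} (λ _ → refl) y≗

  form-sym : ∀ x y → ⟨ x , y ⟩ ≡ ⟨ y , x ⟩
  form-sym x y = trans (∑-comm (λ i j → x i * y j * gram B i j)) (∑-cong (λ j → ∑-cong (λ i →
    cong₂ _*_ (ℤP.*-comm (x i) (y j)) (gram-sym i j))))

  form-subˡ : ∀ x c u y → ⟨ (λ k → x k - c * u k) , y ⟩ ≡ ⟨ x , y ⟩ - c * ⟨ u , y ⟩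
  form-subˡ x c u y = begin
      ⟨ (λ k → x k - c * u k) , y ⟩
    ≡⟨ form-pairing (λ k → x k - c * u k) y ⟩
      ∑ (λ i → (x i - c * u i) * P i)
    ≡⟨ ∑-cong (λ i → distribute (x i) c (u i) (P i)) ⟩
      ∑ (λ i → x i * P i + (- c) * (u i * P i))
    ≡⟨ ∑-+ (λ i → x i * P i) (λ i → (- c) * (u i * P i)) ⟩
      ∑ (λ i → x i * P i) + ∑ (λ i → (- c) * (u i * P i))
    ≡⟨ cong₂ (λ s t → s + t) (sym (form-pairing x y)) (∑-*ˡ (- c) (λ i → u i * P i)) ⟩
      ⟨ x , y ⟩ + (- c) * ∑ (λ i → u i * P i)
    ≡⟨ cong (λ t → ⟨ x , y ⟩ + (- c) * t) (sym (form-pairing u y)) ⟩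
      ⟨ x , y ⟩ + (- c) * ⟨ u , y ⟩
    ≡⟨ cong (_+_ ⟨ x , y ⟩) (sym (ℤP.neg-distribˡ-* c ⟨ u , y ⟩)) ⟩
      ⟨ x , y ⟩ - c * ⟨ u , y ⟩
    ∎
    where
      open ≡-Reasoning
      P = pairing y
      distribute : ∀ a c d e → (a - c * d) * e ≡ a * e + (- c) * (d * e)
      distribute = solve-∀

  form-scaleˡ : ∀ c x y → ⟨ (λ k → c * x k) , y ⟩ ≡ c * ⟨ x , y ⟩
  form-scaleˡ c x y = trans (form-pairing (λ k → c * x k) y)
    (trans (∑-cong (λ i → ℤP.*-assoc c (x i) (pairing y i)))
      (trans (∑-*ˡ c (λ i → x i * pairing y i)) (cong (c *_) (sym (form-pairing x y)))))

  form-negˡ : ∀ x y → ⟨ neg x , y ⟩ ≡ - ⟨ x , y ⟩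
  form-negˡ x y = trans (form-congˡ y (λ k → sym (ℤP.-1*i≡-i (x k))))
    (trans (form-scaleˡ (- + 1) x y) (ℤP.-1*i≡-i _))

  form-basisˡ : ∀ m y → ⟨ basis m , y ⟩ ≡ pairing y m
  form-basisˡ m y = trans (form-pairing (basis m) y)
    (trans (∑-δ _ m (λ i i≢m → cong (_* _) (basis-off (≢-sym i≢m))))
      (trans (cong (_* pairing y m) (basis-diag m)) (ℤP.*-identityˡ _)))

  form-basis : ∀ m j → ⟨ basis m , basis j ⟩ ≡ gram B m j
  form-basis m j = trans (form-basisˡ m (basis j))
    (trans (∑-δ _ j (λ i i≢j → cong (_* _) (basis-off (≢-sym i≢j))))
      (trans (cong (_* gram B m j) (basis-diag j)) (ℤP.*-identityˡ _)))

  simple-norm : ∀ i → ⟨ basis i , basis i ⟩ ≡ + 2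
  simple-norm i = trans (form-basis i i) (gram-diag i)

  -- ⟨ r_u x , y ⟩ = ⟨x,y⟩ - ⟨x,u⟩⟨u,y⟩, which is symmetric in x and y.
  reflect-formˡ : ∀ u x y → ⟨ reflect B u x , y ⟩ ≡ ⟨ x , y ⟩ - ⟨ x , u ⟩ * ⟨ u , y ⟩
  reflect-formˡ u x y = form-subˡ x ⟨ x , u ⟩ u y

  reflect-self-adjoint : ∀ u x y → ⟨ reflect B u x , y ⟩ ≡ ⟨ x , reflect B u y ⟩
  reflect-self-adjoint u x y = begin
      ⟨ reflect B u x , y ⟩
    ≡⟨ reflect-formˡ u x y ⟩
      ⟨ x , y ⟩ - ⟨ x , u ⟩ * ⟨ u , y ⟩
    ≡⟨ cong₂ _-_ (form-sym x y)
         (trans (ℤP.*-comm ⟨ x , u ⟩ ⟨ u , y ⟩) (cong₂ _*_ (form-sym u y) (form-sym x u))) ⟩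
      ⟨ y , x ⟩ - ⟨ y , u ⟩ * ⟨ u , x ⟩
    ≡⟨ sym (reflect-formˡ u y x) ⟩
      ⟨ reflect B u y , x ⟩
    ≡⟨ form-sym _ x ⟩
      ⟨ x , reflect B u y ⟩
    ∎
    where open ≡-Reasoning

  reflect-cong : ∀ u {x y} → x ≗ y → reflect B u x ≗ reflect B u y
  reflect-cong u x≗y k = cong₂ (λ p q → p - q * u k) (x≗y k) (form-congˡ u x≗y)

  reflect-involutive : ∀ {u} → ⟨ u , u ⟩ ≡ + 2 → ∀ x → reflect B u (reflect B u x) ≗ x
  reflect-involutive {u} uu x k = begin
      reflect B u x k - ⟨ reflect B u x , u ⟩ * u k
    ≡⟨ cong (λ t → reflect B u x k - t * u k) (reflect-formˡ u x u) ⟩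
      (x k - X * u k) - (X - X * ⟨ u , u ⟩) * u k
    ≡⟨ cong (λ t → (x k - X * u k) - (X - X * t) * u k) uu ⟩
      (x k - X * u k) - (X - X * + 2) * u k
    ≡⟨ cancels (x k) X (u k) ⟩
      x k
    ∎
    where
      open ≡-Reasoning
      X = ⟨ x , u ⟩
      cancels : ∀ a p q → (a - p * q) - (p - p * + 2) * q ≡ a
      cancels = solve-∀

  reflect-isometry : ∀ {u} → ⟨ u , u ⟩ ≡ + 2 → ∀ x y → ⟨ reflect B u x , reflect B u y ⟩ ≡ ⟨ x , y ⟩
  reflect-isometry {u} uu x y = trans (reflect-self-adjoint u x _) (form-congʳ x (reflect-involutive uu y))

  reflect-linear : ∀ u x c v → reflect B u (λ k → x k - c * v k) ≗ (λ k → reflect B u x k - c * reflect B u v k)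
  reflect-linear u x c v k = begin
      (x k - c * v k) - ⟨ (λ t → x t - c * v t) , u ⟩ * u k
    ≡⟨ cong (λ t → (x k - c * v k) - t * u k) (form-subˡ x c v u) ⟩
      (x k - c * v k) - (⟨ x , u ⟩ - c * ⟨ v , u ⟩) * u k
    ≡⟨ regroup (x k) c (v k) ⟨ x , u ⟩ ⟨ v , u ⟩ (u k) ⟩
      (x k - ⟨ x , u ⟩ * u k) - c * (v k - ⟨ v , u ⟩ * u k)
    ∎
    where
      open ≡-Reasoning
      regroup : ∀ a c d e f g → (a - c * d) - (e - c * f) * g ≡ (a - e * g) - c * (d - f * g)
      regroup = solve-∀

  reflect-conjugate : ∀ {u} → ⟨ u , u ⟩ ≡ + 2 → ∀ β x →
                      reflect B u (reflect B β (reflect B u x)) ≗ reflect B (reflect B u β) x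
  reflect-conjugate {u} uu β x k = begin
      reflect B u (reflect B β z) k
    ≡⟨ reflect-linear u z ⟨ z , β ⟩ β k ⟩
      reflect B u z k - ⟨ z , β ⟩ * reflect B u β k
    ≡⟨ cong₂ (λ p q → p - q * reflect B u β k) (reflect-involutive uu x k) (reflect-self-adjoint u x β) ⟩
      x k - ⟨ x , reflect B u β ⟩ * reflect B u β k
    ∎
    where
      open ≡-Reasoning
      z = reflect B u x

  act-++ : ∀ v w x → act B (v ++ w) x ≗ act B v (act B w x)
  act-++ []      w x = λ _ → refl
  act-++ (a ∷ v) w x = reflect-cong (basis a) (act-++ v w x)

  act-isometry : ∀ w x y → ⟨ act B w x , act B w y ⟩ ≡ ⟨ x , y ⟩
  act-isometry []      x y = refl
  act-isometry (a ∷ w) x y = trans (reflect-isometry (simple-norm a) (act B w x) (act B w y)) (act-isometry w x y)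

  act-adjoint : ∀ w x y → ⟨ act B w x , y ⟩ ≡ ⟨ x , act B (reverse w) y ⟩
  act-adjoint []      x y = refl
  act-adjoint (a ∷ w) x y = begin
      ⟨ reflect B (basis a) (act B w x) , y ⟩
    ≡⟨ reflect-self-adjoint (basis a) (act B w x) y ⟩
      ⟨ act B w x , reflect B (basis a) y ⟩
    ≡⟨ act-adjoint w x _ ⟩
      ⟨ x , act B (reverse w) (reflect B (basis a) y) ⟩
    ≡⟨ form-congʳ x (λ k → sym (act-++ (reverse w) [ a ] y k)) ⟩
      ⟨ x , act B (reverse w ++ [ a ]) y ⟩
    ≡⟨ cong (λ v → ⟨ x , act B v y ⟩) (sym (unfold-reverse a w)) ⟩
      ⟨ x , act B (reverse (a ∷ w)) y ⟩
    ∎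
    where open ≡-Reasoning

  root : Word n → Fin n → Vect n
  root w i = act B w (basis i)

  root-norm : ∀ w i → ⟨ root w i , root w i ⟩ ≡ + 2
  root-norm w i = trans (act-isometry w _ _) (simple-norm i)

  real-root-norm : ∀ {α} → RealRoot B α → ⟨ α , α ⟩ ≡ + 2
  real-root-norm (w , i , α≗) = trans (form-cong α≗ α≗) (root-norm w i)

  root-transfer : ∀ w i w' j → ⟨ root w i , root w' j ⟩ ≡ ⟨ basis i , root (reverse w ++ w') j ⟩
  root-transfer w i w' j =
    trans (act-adjoint w _ _) (form-congʳ (basis i) (λ k → sym (act-++ (reverse w) w' (basis j) k)))

  act-conjugate : ∀ w i x → act B (w ++ i ∷ reverse w) x ≗ reflect B (root w i) x
  act-conjugate []      i x k = refl
  act-conjugate (a ∷ w) i x k = begin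
      act B ((a ∷ w) ++ i ∷ reverse (a ∷ w)) x k
    ≡⟨ cong (λ v → act B v x k) word≡ ⟩
      reflect B (basis a) (act B (P ++ [ a ]) x) k
    ≡⟨ reflect-cong (basis a) (act-++ P [ a ] x) k ⟩
      reflect B (basis a) (act B P (reflect B (basis a) x)) k
    ≡⟨ reflect-cong (basis a) (act-conjugate w i _) k ⟩
      reflect B (basis a) (reflect B (root w i) (reflect B (basis a) x)) k
    ≡⟨ reflect-conjugate (simple-norm a) (root w i) x k ⟩
      reflect B (root (a ∷ w) i) x k
    ∎
    where
      open ≡-Reasoning
      P = w ++ i ∷ reverse w
      word≡ : (a ∷ w) ++ i ∷ reverse (a ∷ w) ≡ a ∷ P ++ [ a ]
      word≡ = cong (a ∷_) (trans (cong (λ t → w ++ i ∷ t) (unfold-reverse a w))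
                                 (sym (++-assoc w (i ∷ reverse w) [ a ])))

  -- If r_α = r_β then 2α = ⟨α,β⟩β (apply both reflections to α) ...
  reflection-twice-root : ∀ {α β} → ⟨ α , α ⟩ ≡ + 2 → (∀ x → reflect B α x ≗ reflect B β x) →
                          ∀ k → + 2 * α k ≡ ⟨ α , β ⟩ * β k
  reflection-twice-root {α} {β} αα same k = begin
      + 2 * α k                              ≡⟨ expand (α k) ⟩
      α k - (α k - + 2 * α k)                ≡⟨ cong (λ t → α k - (α k - t * α k)) (sym αα) ⟩
      α k - reflect B α α k                  ≡⟨ cong (_-_ (α k)) (same α k) ⟩
      α k - (α k - ⟨ α , β ⟩ * β k)          ≡⟨ contract (α k) ⟨ α , β ⟩ (β k) ⟩
      ⟨ α , β ⟩ * β k                        ∎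
    where
      open ≡-Reasoning
      expand : ∀ a → + 2 * a ≡ a - (a - + 2 * a)
      expand = solve-∀
      contract : ∀ a c d → a - (a - c * d) ≡ c * d
      contract = solve-∀

  -- ... so ⟨α,β⟩² = ⟨⟨α,β⟩β , α⟩ = ⟨2α , α⟩ = 4 and ⟨α,β⟩ = ±2: a reflection
  -- determines its root up to sign.
  reflection-determines-root : ∀ {α β} → ⟨ α , α ⟩ ≡ + 2 →
                               (∀ x → reflect B α x ≗ reflect B β x) → α ≗ β ⊎ α ≗ neg β
  reflection-determines-root {α} {β} αα same = Sum.map from-plus from-minus (square-four c c²≡4)
    where
      c = ⟨ α , β ⟩
      twice = reflection-twice-root αα same
      c²≡4 : c * c ≡ + 4
      c²≡4 = begin
          c * c                        ≡⟨ cong (c *_) (form-sym α β) ⟩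
          c * ⟨ β , α ⟩                ≡⟨ sym (form-scaleˡ c β α) ⟩
          ⟨ (λ k → c * β k) , α ⟩      ≡⟨ form-congˡ α (λ k → sym (twice k)) ⟩
          ⟨ (λ k → + 2 * α k) , α ⟩    ≡⟨ form-scaleˡ (+ 2) α α ⟩
          + 2 * ⟨ α , α ⟩              ≡⟨ cong (+ 2 *_) αα ⟩
          + 4                          ∎
        where open ≡-Reasoning
      from-plus : c ≡ + 2 → α ≗ β
      from-plus c≡2 k = ℤP.*-cancelˡ-≡ (+ 2) (α k) (β k) (trans (twice k) (cong (_* β k) c≡2))
      from-minus : c ≡ - + 2 → α ≗ neg β
      from-minus c≡-2 k = ℤP.*-cancelˡ-≡ (+ 2) (α k) (- β k)
        (trans (twice k) (trans (cong (_* β k) c≡-2) (move-sign (β k))))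
        where
          move-sign : ∀ d → - + 2 * d ≡ + 2 * (- d)
          move-sign = solve-∀

  simple-pairing-reflect : ∀ a m y →
    ⟨ basis m , reflect B (basis a) y ⟩ ≡ ⟨ basis m , y ⟩ - ⟨ basis a , y ⟩ * gram B a m
  simple-pairing-reflect a m y = begin
      ⟨ basis m , reflect B (basis a) y ⟩
    ≡⟨ form-sym (basis m) (reflect B (basis a) y) ⟩
      ⟨ reflect B (basis a) y , basis m ⟩
    ≡⟨ reflect-formˡ (basis a) y (basis m) ⟩
      ⟨ y , basis m ⟩ - ⟨ y , basis a ⟩ * ⟨ basis a , basis m ⟩
    ≡⟨ cong₂ (λ p q → p - q * ⟨ basis a , basis m ⟩) (form-sym y (basis m)) (form-sym y (basis a)) ⟩
      ⟨ basis m , y ⟩ - ⟨ basis a , y ⟩ * ⟨ basis a , basis m ⟩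
    ≡⟨ cong (λ t → ⟨ basis m , y ⟩ - ⟨ basis a , y ⟩ * t) (form-basis a m) ⟩
      ⟨ basis m , y ⟩ - ⟨ basis a , y ⟩ * gram B a m
    ∎
    where open ≡-Reasoning

  lead-pairing-reflect : ∀ a y → ⟨ basis a , reflect B (basis a) y ⟩ ≡ - ⟨ basis a , y ⟩
  lead-pairing-reflect a y =
    trans (simple-pairing-reflect a a y) (trans (cong (λ t → p - p * t) (gram-diag a)) (halve p))
    where
      p = ⟨ basis a , y ⟩
      halve : ∀ p → p - p * + 2 ≡ - p
      halve = solve-∀

  reflect-simple-coord : ∀ a y k → reflect B (basis a) y k ≡ y k + (- ⟨ basis a , y ⟩) * basis a k
  reflect-simple-coord a y k =
    trans (cong (λ t → y k - t * basis a k) (form-sym y (basis a)))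
          (cong (_+_ (y k)) (ℤP.neg-distribˡ-* ⟨ basis a , y ⟩ (basis a k)))

  record Dominant (f : Fin n) (y : Vect n) : Set where
    field
      lead-pairing  : + 2 ≤ ⟨ basis f , y ⟩
      other-pairing : ∀ m → m ≢ f → ⟨ basis m , y ⟩ ≤ - ⟨ basis f , y ⟩
      nonneg        : ∀ k → + 0 ≤ y k
      lead-coord    : + 1 ≤ y f

  dominant-basis : ∀ j → Dominant j (basis j)
  dominant-basis j = record
    { lead-pairing  = ℤP.≤-reflexive (sym (simple-norm j))
    ; other-pairing = λ m m≢j →
        subst₂ _≤_ (sym (form-basis m j)) (cong -_ (sym (simple-norm j))) (gram-off≤-2 m≢j)
    ; nonneg        = basis-nonneg j
    ; lead-coord    = ℤP.≤-reflexive (sym (basis-diag j))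
    }

  -- The gain
  -- D = -⟨v_a,y⟩ is at least ⟨v_f,y⟩ ≥ 2, and g_am ≤ -2 does the rest.
  dominant-step : ∀ {f y} a → a ≢ f → Dominant f y → Dominant a (reflect B (basis a) y)
  dominant-step {f} {y} a a≢f dom = record
    { lead-pairing  = subst (+ 2 ≤_) (sym lead≡D) D≥2
    ; other-pairing = other
    ; nonneg        = λ k → subst (+ 0 ≤_) (sym (reflect-simple-coord a y k))
                              (ℤP.+-mono-≤ (nonneg k) (gain-nonneg k))
    ; lead-coord    = subst (+ 1 ≤_) (sym coord-a)
                        (ℤP.≤-trans (+≤+ (s≤s z≤n)) (ℤP.+-mono-≤ (nonneg a) D≥2))
    }
    where
      open Dominant dom
      P : Fin n → ℤ
      P m = ⟨ basis m , y ⟩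
      D = - P a
      Pf≤D : P f ≤ D
      Pf≤D = subst (_≤ D) (ℤP.neg-involutive (P f)) (ℤP.neg-mono-≤ (other-pairing a a≢f))
      D≥2 : + 2 ≤ D
      D≥2 = ℤP.≤-trans lead-pairing Pf≤D
      Pf≥0 : + 0 ≤ P f
      Pf≥0 = ℤP.≤-trans (+≤+ z≤n) lead-pairing
      D≥0 : + 0 ≤ D
      D≥0 = ℤP.≤-trans Pf≥0 Pf≤D
      scale : ∀ {p q} → p ≤ q → D * p ≤ D * q
      scale = ℤP.*-monoˡ-≤-nonNeg D {{ℤ.nonNegative D≥0}}
      gain-nonneg : ∀ k → + 0 ≤ D * basis a k
      gain-nonneg k = subst (_≤ D * basis a k) (ℤP.*-zeroʳ D) (scale (basis-nonneg a k))
      Pm≤D : ∀ m → P m ≤ D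
      Pm≤D m with m ≟ᶠ f
      ... | yes refl = Pf≤D
      ... | no m≢f   = ℤP.≤-trans (other-pairing m m≢f) (ℤP.≤-trans (ℤP.neg-mono-≤ Pf≥0) D≥0)
      lead≡D : ⟨ basis a , reflect B (basis a) y ⟩ ≡ D
      lead≡D = lead-pairing-reflect a y
      other : ∀ m → m ≢ a → ⟨ basis m , reflect B (basis a) y ⟩ ≤ - ⟨ basis a , reflect B (basis a) y ⟩
      other m m≢a = begin
          ⟨ basis m , reflect B (basis a) y ⟩  ≡⟨ simple-pairing-reflect a m y ⟩
          P m - P a * gram B a m               ≡⟨ cong (_+_ (P m)) (ℤP.neg-distribˡ-* (P a) (gram B a m)) ⟩
          P m + D * gram B a m                 ≤⟨ ℤP.+-mono-≤ (Pm≤D m) (scale (gram-off≤-2 (≢-sym m≢a))) ⟩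
          D + D * - + 2                        ≡⟨ collapse D ⟩
          - D                                  ≡⟨ cong -_ (sym lead≡D) ⟩
          - ⟨ basis a , reflect B (basis a) y ⟩ ∎
        where
          open ℤP.≤-Reasoning
          collapse : ∀ d → d + d * - + 2 ≡ - d
          collapse = solve-∀
      coord-a : reflect B (basis a) y a ≡ y a + D
      coord-a = trans (reflect-simple-coord a y a)
        (cong (_+_ (y a)) (trans (cong (D *_) (basis-diag a)) (ℤP.*-identityʳ D)))

  root-dominant : ∀ z j → Reduced (z ++ [ j ]) → Dominant (head-or z j) (root z j)
  root-dominant []      j _ = dominant-basis j
  root-dominant (a ∷ z) j r = dominant-step a (head-or-≢ z j r) (root-dominant z j (reduced-tail r))

  simple-pairing-negative : ∀ i z j → Reduced (i ∷ z ++ [ j ]) → ⟨ basis i , root z j ⟩ ≤ - + 2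
  simple-pairing-negative i z j r =
    ℤP.≤-trans (other-pairing i (head-or-≢ z j r)) (ℤP.neg-mono-≤ lead-pairing)
    where open Dominant (root-dominant z j (reduced-tail r))

  -- Pairings of roots of reduced conjugate forms are positive only if the
  -- words are nested: strip the common first letters (an isometry); if the
  -- first letters then differ, s_i w⁻¹ w' s_j is reduced and the pairing is
  -- at most -2.
  positive-pairing⇒nested : ∀ w i w' j → Reduced (w ++ [ i ]) → Reduced (w' ++ [ j ]) →
                            + 0 < ⟨ root w i , root w' j ⟩ → Nested w i w' j
  positive-pairing⇒nested w i w' j r r' pos with head-or w i ≟ᶠ head-or w' j
  ... | no heads≢ = contradiction (ℤP.<-≤-trans pos pairing≤-2) λ ()
    where
      pairing≤-2 : ⟨ root w i , root w' j ⟩ ≤ - + 2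
      pairing≤-2 = subst (_≤ - + 2) (sym (root-transfer w i w' j))
                     (simple-pairing-negative i (reverse w ++ w') j (reduced-zigzag w i w' j r r' heads≢))
  positive-pairing⇒nested []      i []       j _ _ _ | yes i≡j = inj₁ (refl , i≡j)
  positive-pairing⇒nested []      i (c ∷ w') j _ _ _ | yes i≡c = inj₂ (inj₁ (w' , cong (_∷ w') (sym i≡c)))
  positive-pairing⇒nested (a ∷ w) i []       j _ _ _ | yes a≡j = inj₂ (inj₂ (w , cong (_∷ w) a≡j))
  positive-pairing⇒nested (a ∷ w) i (a ∷ w') j r r' pos | yes refl =
    nested-cons a (positive-pairing⇒nested w i w' j (reduced-tail r) (reduced-tail r')
      (subst (+ 0 <_) (reflect-isometry (simple-norm a) (root w i) (root w' j)) pos))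

  -- If s_i U s_j is reduced then ⟨ w(v_i) , w s_i U (v_j) ⟩ = -⟨ v_i , U(v_j) ⟩ ≥ 2.
  extension-pairing : ∀ w i U j → Reduced (i ∷ U ++ [ j ]) → + 2 ≤ ⟨ root w i , root (w ++ i ∷ U) j ⟩
  extension-pairing w i U j r =
    subst (+ 2 ≤_) (sym pairing≡) (ℤP.neg-mono-≤ (simple-pairing-negative i U j r))
    where
      open ≡-Reasoning
      pairing≡ : ⟨ root w i , root (w ++ i ∷ U) j ⟩ ≡ - ⟨ basis i , root U j ⟩
      pairing≡ = begin
          ⟨ root w i , root (w ++ i ∷ U) j ⟩              ≡⟨ form-congʳ (root w i) (act-++ w (i ∷ U) (basis j)) ⟩
          ⟨ root w i , act B w (root (i ∷ U) j) ⟩        ≡⟨ act-isometry w (basis i) (root (i ∷ U) j) ⟩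
          ⟨ basis i , reflect B (basis i) (root U j) ⟩   ≡⟨ lead-pairing-reflect i (root U j) ⟩
          - ⟨ basis i , root U j ⟩                       ∎

  positive-sign : ∀ {α β f} → Positive α → α ≗ β ⊎ α ≗ neg β → + 1 ≤ β f → α ≗ β
  positive-sign pα (inj₁ α≗β)  _   = α≗β
  positive-sign {f = f} pα (inj₂ α≗-β) β≥1 =
    contradiction (ℤP.≤-trans (subst (+ 0 ≤_) (α≗-β f) (pα f)) (ℤP.neg-mono-≤ β≥1)) λ ()

  negative-sign : ∀ {α β f} → Negative α → α ≗ β ⊎ α ≗ neg β → + 1 ≤ β f → α ≗ neg β
  negative-sign {f = f} nα (inj₁ α≗β) β≥1 =
    contradiction (ℤP.≤-trans β≥1 (subst (_≤ + 0) (α≗β f) (nα f))) λ { (+≤+ ()) }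
  negative-sign nα (inj₂ α≗-β) _ = α≗-β

  RootReflection : Vect n → Word n → Set
  RootReflection α r = RealRoot B α × IsReflectionOf B r α

  signed-root : ∀ {α r w i} → RootReflection α r → r ≡ w ++ i ∷ reverse w →
                (Positive α → α ≗ root w i) × (Negative α → α ≗ neg (root w i))
  signed-root {w = w} {i} (rα , red-r , acts) r≡ =
    (λ pα → positive-sign pα ±root lead-coord) , (λ nα → negative-sign nα ±root lead-coord)
    where
      open Dominant (root-dominant w i (palindrome-prefix red-r r≡))
      ±root = reflection-determines-root (real-root-norm rα)
                (λ x k → trans (sym (acts x k)) (trans (cong (λ v → act B v x k) r≡) (act-conjugate w i x k)))

  Cosigned : Vect n → Vect n → Set
  Cosigned α α' = (Positive α × Positive α') ⊎ (Negative α × Negative α')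

  SameSign : Vect n → Vect n → Vect n → Vect n → Set
  SameSign α α' β β' = (α ≗ β × α' ≗ β') ⊎ (α ≗ neg β × α' ≗ neg β')

  same-sign-roots : ∀ {α α' r r' w i w' j} → Cosigned α α' → RootReflection α r → RootReflection α' r' →
                    r ≡ w ++ i ∷ reverse w → r' ≡ w' ++ j ∷ reverse w' → SameSign α α' (root w i) (root w' j)
  same-sign-roots (inj₁ (pα , pα')) ρ ρ' r≡ r'≡ =
    inj₁ (proj₁ (signed-root ρ r≡) pα , proj₁ (signed-root ρ' r'≡) pα')
  same-sign-roots (inj₂ (nα , nα')) ρ ρ' r≡ r'≡ =
    inj₂ (proj₂ (signed-root ρ r≡) nα , proj₂ (signed-root ρ' r'≡) nα')

  same-sign-form : ∀ {α α' β β'} → SameSign α α' β β' → ⟨ α , α' ⟩ ≡ ⟨ β , β' ⟩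
  same-sign-form (inj₁ (α≗ , α'≗)) = form-cong α≗ α'≗
  same-sign-form {α} {α'} {β} {β'} (inj₂ (α≗ , α'≗)) = begin
      ⟨ α , α' ⟩              ≡⟨ form-cong α≗ α'≗ ⟩
      ⟨ neg β , neg β' ⟩      ≡⟨ form-negˡ β (neg β') ⟩
      - ⟨ β , neg β' ⟩        ≡⟨ cong -_ (trans (form-sym β (neg β')) (form-negˡ β' β)) ⟩
      - - ⟨ β' , β ⟩          ≡⟨ trans (ℤP.neg-involutive _) (form-sym β' β) ⟩
      ⟨ β , β' ⟩              ∎
    where open ≡-Reasoning

  same-sign-≗ : ∀ {α α' β β'} → SameSign α α' β β' → β ≗ β' → α ≗ α'
  same-sign-≗ (inj₁ (α≗ , α'≗)) β≗β' k = trans (α≗ k) (trans (β≗β' k) (sym (α'≗ k)))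
  same-sign-≗ (inj₂ (α≗ , α'≗)) β≗β' k = trans (α≗ k) (trans (cong -_ (β≗β' k)) (sym (α'≗ k)))

  ≺⇒positive : ∀ {α α' r r'} → Cosigned α α' → RootReflection α r → RootReflection α' r' →
               r ≺ r' → + 0 < ⟨ α , α' ⟩
  ≺⇒positive signs ρ ρ' r≺r' =
    subst (+ 0 <_) (sym (same-sign-form (same-sign-roots signs ρ ρ' r≡ r'≡)))
      (ℤP.<-≤-trans (+<+ (s≤s z≤n)) (extension-pairing w i U j reduced))
    where open Extension (≺⇒extension r≺r')

  positive⇒bad : ∀ {α α' r r'} → Cosigned α α' → RootReflection α r → RootReflection α' r' →
                 ¬ (α ≗ α') → Palindrome r → Palindrome r' → + 0 < ⟨ α , α' ⟩ → r ≺ r' ⊎ r' ≺ r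
  positive⇒bad {r = r} {r'} signs ρ@(_ , red-r , _) ρ'@(_ , red-r' , _) α≢α' (w , i , r≡) (w' , j , r'≡) pos =
    nested⇒bad (positive-pairing⇒nested w i w' j (palindrome-prefix red-r r≡) (palindrome-prefix red-r' r'≡)
                  (subst (+ 0 <_) (same-sign-form aligned) pos))
    where
      aligned = same-sign-roots signs ρ ρ' r≡ r'≡
      nested⇒bad : Nested w i w' j → r ≺ r' ⊎ r' ≺ r
      nested⇒bad (inj₁ (w≡w' , i≡j)) =
        contradiction (same-sign-≗ aligned (λ k → cong₂ (λ v t → root v t k) w≡w' i≡j)) α≢α'
      nested⇒bad (inj₂ (inj₁ (u , w'≡))) = inj₁ (extension⇒≺ u r≡ r'≡ red-r red-r' w'≡)
      nested⇒bad (inj₂ (inj₂ (u , w≡)))  = inj₂ (extension⇒≺ u r'≡ r≡ red-r' red-r w≡)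

proposition6p7 : ∀ {n : ℕ} (B : ExchangeMatrix n) (α α' : Vect n) (r r' : Word n) →
    RealRoot B α → RealRoot B α' →
    ¬ (∀ k → α k ≡ α' k) →
    (Positive α × Positive α') ⊎ (Negative α × Negative α') →
    IsReflectionOf B r α → IsReflectionOf B r' α' →
    HasArc r → HasArc r' →
    ((r ≺ r' ⊎ r' ≺ r) ⇔ (+ 0 < form B α α'))
proposition6p7 B α α' r r' rα rα' α≢α' signs reflα reflα' arcγ arcγ' = mk⇔ bad⇒positive positive⇒bad'
  where
    ρ  = rα , reflα
    ρ' = rα' , reflα'
    bad⇒positive : r ≺ r' ⊎ r' ≺ r → + 0 < form B α α'
    bad⇒positive (inj₁ r≺r') = ≺⇒positive B signs ρ ρ' r≺r'
    bad⇒positive (inj₂ r'≺r) =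
      subst (+ 0 <_) (form-sym B α' α) (≺⇒positive B (Sum.map swap swap signs) ρ' ρ r'≺r)
    positive⇒bad' : + 0 < form B α α' → r ≺ r' ⊎ r' ≺ r
    positive⇒bad' = positive⇒bad B signs ρ ρ' α≢α' (arc-palindrome arcγ) (arc-palindrome arcγ')
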